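{- If $\Gamma\vdash M$ is derivable and $\Gamma\vdash M$ is a $\sigma\pi\alpha$-normal form (with respect to $\rightsquigarrow$), then $M$ is pure, i.e. $M$ contains no sub-term of the shape $s\circ N$.
   Context: Calculus $\lambda\pi$: terms $M,N::= a\mid MN\mid\lambda a.M\mid s\circ M$, substitutions $s,q::= id\mid\pi_a\mid\langle s\,,\,N\backslash a\rangle\mid s\circ q$. Derivable judgements (contexts = lists of variables with repetitions): $\Gamma,a\vdash a$; $\Gamma\vdash a\Rightarrow\Gamma,b\vdash a$ ($a\neq b$); application; $\Gamma,a\vdash M\Rightarrow\Gamma\vdash\lambda a.M$; $\Gamma\vdash s\triangleright\Delta,\Delta\vdash M\Rightarrow\Gamma\vdash s\circ M$; $\Gamma\vdash id\triangleright\Gamma$; $\Gamma,a\vdash\pi_a\triangleright\Gamma$; $\Gamma\vdash s\triangleright\Delta,\Gamma\vdash N\Rightarrow\Gamma\vdash\langle s\,,\,N\backslash a\rangle\triangleright\Delta,a$; $\Gamma\vdash s\triangleright\Delta,\Delta\vdash q\triangleright\Sigma\Rightarrow\Gamma\vdash s\circ q\triangleright\Sigma$. Free variables: $FV(M)=\langle FV_1(M),FV_2(M),\ldots\rangle$ with $FV(a)=\langle\{a\},\emptyset,\ldots\rangle$, $FV(MN)=FV(M)\cup FV(N)$, $FV(\lambda a.M)=O_{\lambda a}(FV(M))$, $FV(s\circ M)=O_s(FV(M))$, where $O_{\lambda a}(\mathcal A)=\langle(\mathcal A_1\setminus\{a\})\cup\mathcal A_2,\mathcal A_3,\ldots\rangle$,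 $O_{id}=$ identity, $O_{\pi_a}(\mathcal A)=\langle\emptyset,\mathcal A_1,\mathcal A_2,\ldots\rangle$, $O_{s\circ q}=O_s\circ O_q$, $O_{\langle s,N\backslash a\rangle}(\mathcal A)=O_s(O_{\lambda a}(\mathcal A))\cup FV(N)$; $FV(\Gamma\vdash M)=FV(\lambda\Gamma.M)$ with $\lambda\,nil.M=M$, $\lambda\Sigma,a.M=\lambda\Sigma.\lambda a.M$. $\sigma\pi\alpha$ ($\lambda\pi$ without Beta) is the compatible closure of: (Abs) $s\circ\lambda a.M\rightarrow\lambda a.\langle\pi_a\circ s\,,\,a\backslash a\rangle\circ M$; (App) $s\circ(MN)\rightarrow(s\circ M)(s\circ N)$; (ConsVar) $\langle s\,,\,N\backslash a\rangle\circ a\rightarrow N$; (New) $\langle s\,,\,N\backslash a\rangle\circ b\rightarrow s\circ b$ ($a\neq b$); (IdVar) $id\circ a\rightarrow a$; (Clos) $s\circ(q\circ M)\rightarrow(s\circ q)\circ M$; (Ass) $s\circ(q\circ r)\rightarrow(s\circ q)\circ r$; (IdR) $s\circ id\rightarrow s$; (IdShift) $id\circ\pi_a\rightarrow\pi_a$; (ConsShift) $\langle s\,,\,N\backslash a\rangle\circ\pi_a\rightarrow s$; (Map) $s\circ\langle q\,,\,N\backslash a\rangle\rightarrow\langle s\circ q\,,\,s\circ N\backslash a\rangle$; ($\pi_1$) $\pi_a\circ b\rightarrow b$ ($a\neq b$); ($\pi_2$) $(s\circ\pi_a)\circ b\rightarrow s\circ b$ ($a\neq b$); ($\alpha_1$)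 $\lambda a.M\rightarrow\lambda b.\langle\pi_b\,,\,b\backslash a\rangle\circ M$ if $a\in\bigcup_iFV_i(\lambda a.M)$ and $b\notin\bigcup_iFV_i(\lambda a.M)$. On judgements, $\Gamma\vdash M_1\rightsquigarrow\Gamma\vdash M_2$ whenever $M_1\rightarrow M_2$, and ($\alpha_2$) $\Gamma,a,\Delta\vdash M\rightsquigarrow\Gamma,b,\Delta\vdash\Uparrow_\Delta\langle\pi_b\,,\,b\backslash a\rangle\circ M$ if $a\in\bigcup_iFV_i(a,\Delta\vdash M)$ and $b\notin\bigcup_iFV_i(a,\Delta\vdash M)$, where $\Uparrow_{nil}(s)=s$, $\Uparrow_{\Sigma,a}(s)=\langle\pi_a\circ\Uparrow_\Sigma(s)\,,\,a\backslash a\rangle$. -}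

module Defs where

open import Data.Nat using (ℕ; zero; suc)
open import Data.Product using (Σ; _×_; _,_; ∃)
open import Data.Sum using (_⊎_)
open import Data.Empty using (⊥)
open import Relation.Nullary using (¬_)
open import Relation.Binary.PropositionalEquality using (_≡_; _≢_)

-- Variables: an infinite set with decidable equality (natural numbers).
Var : Set
Var = ℕ

mutual
  -- Terms  M ::= a | M N | λ a. M | s ∘ M
  data Term : Set where
    var : Var → Term
    app : Term → Term → Term
    lam : Var → Term → Term
    sub : Subst → Term → Term

  -- Substitutions  s ::= id | π_a | ⟨ s , N \ a ⟩ | s ∘ q
  data Subst : Set where
    idS  : Subst
    π    : Var → Subst
    cons : Subst → Term → Var → Subst
    comp : Subst → Subst → Subst

-- Contexts: snoc lists of variables (repetitions allowed); Γ , a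
infixl 5 _,,_
data Ctx : Set where
  nil  : Ctx
  _,,_ : Ctx → Var → Ctx

_++c_ : Ctx → Ctx → Ctx
Γ ++c nil = Γ
Γ ++c (Δ ,, a) = (Γ ++c Δ) ,, a

mutual
  data _⊢_ : Ctx → Term → Set where
    ax   : ∀ {Γ a} → (Γ ,, a) ⊢ var a
    weak : ∀ {Γ a b} → Γ ⊢ var a → a ≢ b → (Γ ,, b) ⊢ var a
    tapp : ∀ {Γ M N} → Γ ⊢ M → Γ ⊢ N → Γ ⊢ app M N
    tlam : ∀ {Γ a M} → (Γ ,, a) ⊢ M → Γ ⊢ lam a M
    tsub : ∀ {Γ Δ s M} → Γ ⊢ s ▷ Δ → Δ ⊢ M → Γ ⊢ sub s M

  data _⊢_▷_ : Ctx → Subst → Ctx → Set where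
    tid   : ∀ {Γ} → Γ ⊢ idS ▷ Γ
    tπ    : ∀ {Γ a} → (Γ ,, a) ⊢ π a ▷ Γ
    tcons : ∀ {Γ Δ s N a} → Γ ⊢ s ▷ Δ → Γ ⊢ N → Γ ⊢ cons s N a ▷ (Δ ,, a)
    tcomp : ∀ {Γ Δ Σ′ s q} → Γ ⊢ s ▷ Δ → Δ ⊢ q ▷ Σ′ → Γ ⊢ comp s q ▷ Σ′

-- Sequences of sets of variables  𝒜 = ⟨𝒜₁, 𝒜₂, …⟩, as predicates:
-- 𝒜 i x  means  x ∈ 𝒜_{i+1}  (index 0 is the first component).
VarSeq : Set₁
VarSeq = ℕ → Var → Set

_∪ˢ_ : VarSeq → VarSeq → VarSeq
(A ∪ˢ B) i x = A i x ⊎ B i x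

Oλ : Var → VarSeq → VarSeq
Oλ a A zero x = (A 0 x × x ≢ a) ⊎ A 1 x
Oλ a A (suc i) x = A (suc (suc i)) x

mutual
  FV : Term → VarSeq
  FV (var a) zero x = x ≡ a
  FV (var a) (suc i) x = ⊥
  FV (app M N) = FV M ∪ˢ FV N
  FV (lam a M) = Oλ a (FV M)
  FV (sub s M) = O s (FV M)

  O : Subst → VarSeq → VarSeq
  O idS A = A
  O (π a) A zero x = ⊥
  O (π a) A (suc i) x = A i x
  O (cons s N a) A = O s (Oλ a A) ∪ˢ FV N
  O (comp s q) A = O s (O q A)

_∈FV_ : Var → Term → Set
x ∈FV M = ∃ λ i → FV M i x

lamCtx : Ctx → Term → Term
lamCtx nil M = M
lamCtx (Σ′ ,, a) M = lamCtx Σ′ (lam a M)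

_∈FVJ_⊢_ : Var → Ctx → Term → Set
x ∈FVJ Γ ⊢ M = x ∈FV lamCtx Γ M

mutual
  infix 4 _⟶_ _⟶ˢ_
  data _⟶_ : Term → Term → Set where
    Abs     : ∀ {s a M} → sub s (lam a M) ⟶ lam a (sub (cons (comp (π a) s) (var a) a) M)
    App     : ∀ {s M N} → sub s (app M N) ⟶ app (sub s M) (sub s N)
    ConsVar : ∀ {s N a} → sub (cons s N a) (var a) ⟶ N
    New     : ∀ {s N a b} → a ≢ b → sub (cons s N a) (var b) ⟶ sub s (var b)
    IdVar   : ∀ {a} → sub idS (var a) ⟶ var a
    Clos    : ∀ {s q M} → sub s (sub q M) ⟶ sub (comp s q) M
    π₁      : ∀ {a b} → a ≢ b → sub (π a) (var b) ⟶ var b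
    π₂      : ∀ {s a b} → a ≢ b → sub (comp s (π a)) (var b) ⟶ sub s (var b)
    α₁      : ∀ {a b M} → a ∈FV lam a M → ¬ (b ∈FV lam a M) →
              lam a M ⟶ lam b (sub (cons (π b) (var b) a) M)
    appL : ∀ {M M′ N} → M ⟶ M′ → app M N ⟶ app M′ N
    appR : ∀ {M N N′} → N ⟶ N′ → app M N ⟶ app M N′
    lamC : ∀ {a M M′} → M ⟶ M′ → lam a M ⟶ lam a M′
    subL : ∀ {s s′ M} → s ⟶ˢ s′ → sub s M ⟶ sub s′ M
    subR : ∀ {s M M′} → M ⟶ M′ → sub s M ⟶ sub s M′

  data _⟶ˢ_ : Subst → Subst → Set where
    Ass       : ∀ {s q r} → comp s (comp q r) ⟶ˢ comp (comp s q) r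
    IdR       : ∀ {s} → comp s idS ⟶ˢ s
    IdShift   : ∀ {a} → comp idS (π a) ⟶ˢ π a
    ConsShift : ∀ {s N a} → comp (cons s N a) (π a) ⟶ˢ s
    Map       : ∀ {s q N a} → comp s (cons q N a) ⟶ˢ cons (comp s q) (sub s N) a
    consL : ∀ {s s′ N a} → s ⟶ˢ s′ → cons s N a ⟶ˢ cons s′ N a
    consR : ∀ {s N N′ a} → N ⟶ N′ → cons s N a ⟶ˢ cons s N′ a
    compL : ∀ {s s′ q} → s ⟶ˢ s′ → comp s q ⟶ˢ comp s′ q
    compR : ∀ {s q q′} → q ⟶ˢ q′ → comp s q ⟶ˢ comp s q′

lift : Ctx → Subst → Subst
lift nil s = s
lift (Σ′ ,, a) s = cons (comp (π a) (lift Σ′ s)) (var a) a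

Judg : Set
Judg = Ctx × Term

infix 4 _⇝_
data _⇝_ : Judg → Judg → Set where
  red : ∀ {Γ M₁ M₂} → M₁ ⟶ M₂ → (Γ , M₁) ⇝ (Γ , M₂)
  α₂  : ∀ {Γ a b Δ M} →
        a ∈FVJ ((nil ,, a) ++c Δ) ⊢ M →
        ¬ (b ∈FVJ ((nil ,, a) ++c Δ) ⊢ M) →
        (((Γ ,, a) ++c Δ) , M) ⇝ (((Γ ,, b) ++c Δ) , sub (lift Δ (cons (π b) (var b) a)) M)

NormalForm : Judg → Set
NormalForm J = ∀ J′ → ¬ (J ⇝ J′)

data Pure : Term → Set where
  pvar : ∀ {a} → Pure (var a)
  papp : ∀ {M N} → Pure M → Pure N → Pure (app M N)
  plam : ∀ {a M} → Pure M → Pure (lam a M)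

module Submission where

-- The proof is a progress argument.  For every derivable Γ ⊢ M one of three
-- things holds (`Progress`): M is pure; M has a σπα-step; or some entry a of
-- Γ = Γ₁,a,Δ is shadowed, i.e. a ∈ FV(a,Δ ⊢ M), which is exactly the side
-- condition of α₂.  Both of the last two cases give a ⇝-step: for α₂ (and for
-- α₁, used when the shadowed entry is a λ-binder) the fresh variable is
-- 1 + the largest variable name occurring in the term (`fresh`).

open import Defs
open import Data.Product using (Σ; _×_; _,_)
open import Data.Sum using (inj₁; inj₂)
open import Data.Empty using (⊥-elim)
open import Data.Nat using (ℕ; zero; suc; _+_; _⊔_; _≤_)
open import Data.Nat.Properties using (≤-refl; n≮n; m⊔n≤o⇒m≤o; m⊔n≤o⇒n≤o; +-suc; _≟_)
open import Relation.Nullary using (¬_; yes; no)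
open import Relation.Binary.PropositionalEquality using (_≡_; refl; sym; cong; subst; module ≡-Reasoning)

-- An upper bound for every variable name that can be free in a term.
-- The shifts π_a only move variables between levels, so they contribute 0.
mutual
  maxVar : Term → ℕ
  maxVar (var a)   = a
  maxVar (app M N) = maxVar M ⊔ maxVar N
  maxVar (lam a M) = maxVar M
  maxVar (sub s M) = maxVarˢ s ⊔ maxVar M

  maxVarˢ : Subst → ℕ
  maxVarˢ idS          = 0
  maxVarˢ (π a)        = 0
  maxVarˢ (cons s N a) = maxVarˢ s ⊔ maxVar N
  maxVarˢ (comp s q)   = maxVarˢ s ⊔ maxVarˢ q

Bounded : ℕ → VarSeq → Set
Bounded n A = ∀ i x → A i x → x ≤ n

-- O_{λa} only removes variables and moves them down a level.
Oλ-bounded : ∀ {n A} a → Bounded n A → Bounded n (Oλ a A)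
Oλ-bounded a bd zero    x (inj₁ (h , _)) = bd 0 x h
Oλ-bounded a bd zero    x (inj₂ h)       = bd 1 x h
Oλ-bounded a bd (suc i) x h              = bd (suc (suc i)) x h

mutual
  FV-bounded : ∀ {n} M → maxVar M ≤ n → Bounded n (FV M)
  FV-bounded (var a)   a≤n zero x refl = a≤n
  FV-bounded (app M N) ≤n  i x (inj₁ h) = FV-bounded M (m⊔n≤o⇒m≤o _ _ ≤n) i x h
  FV-bounded (app M N) ≤n  i x (inj₂ h) = FV-bounded N (m⊔n≤o⇒n≤o _ _ ≤n) i x h
  FV-bounded (lam a M) ≤n  = Oλ-bounded a (FV-bounded M ≤n)
  FV-bounded (sub s M) ≤n  =
    O-bounded s (m⊔n≤o⇒m≤o _ _ ≤n) (FV-bounded M (m⊔n≤o⇒n≤o _ _ ≤n))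

  O-bounded : ∀ {n A} s → maxVarˢ s ≤ n → Bounded n A → Bounded n (O s A)
  O-bounded idS          _  bd = bd
  O-bounded (π a)        _  bd (suc i) x h = bd i x h
  O-bounded (cons s N a) ≤n bd i x (inj₁ h) =
    O-bounded s (m⊔n≤o⇒m≤o _ _ ≤n) (Oλ-bounded a bd) i x h
  O-bounded (cons s N a) ≤n bd i x (inj₂ h) = FV-bounded N (m⊔n≤o⇒n≤o _ _ ≤n) i x h
  O-bounded (comp s q)   ≤n bd =
    O-bounded s (m⊔n≤o⇒m≤o _ _ ≤n) (O-bounded q (m⊔n≤o⇒n≤o _ _ ≤n) bd)

fresh : ∀ M → ¬ (suc (maxVar M) ∈FV M)
fresh M (i , h) = n≮n (maxVar M) (FV-bounded M ≤-refl i _ h)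

_⊆ˢ_ : VarSeq → VarSeq → Set
A ⊆ˢ B = ∀ i x → A i x → B i x

Oλ-mono : ∀ {A B} a → A ⊆ˢ B → Oλ a A ⊆ˢ Oλ a B
Oλ-mono a A⊆B zero    x (inj₁ (h , x≢a)) = inj₁ (A⊆B 0 x h , x≢a)
Oλ-mono a A⊆B zero    x (inj₂ h)         = inj₂ (A⊆B 1 x h)
Oλ-mono a A⊆B (suc i) x h                = A⊆B (suc (suc i)) x h

lamCtx-mono : ∀ Θ {M M′} → FV M ⊆ˢ FV M′ → FV (lamCtx Θ M) ⊆ˢ FV (lamCtx Θ M′)
lamCtx-mono nil       M⊆M′ = M⊆M′
lamCtx-mono (Θ ,, a) M⊆M′ = lamCtx-mono Θ (Oλ-mono a M⊆M′)

-- Hence a variable free in the judgement Θ ⊢ M stays free when M grows; this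
-- passes a shadowed context entry from a premise of an application to its
-- conclusion.
shadowed-mono : ∀ {a} Θ {M M′} → FV M ⊆ˢ FV M′ → a ∈FVJ Θ ⊢ M → a ∈FVJ Θ ⊢ M′
shadowed-mono {a} Θ M⊆M′ (i , h) = i , lamCtx-mono Θ M⊆M′ i a h

shadowed-appˡ : ∀ {a} Θ {M} N → a ∈FVJ Θ ⊢ M → a ∈FVJ Θ ⊢ app M N
shadowed-appˡ Θ N = shadowed-mono Θ (λ _ _ → inj₁)

shadowed-appʳ : ∀ {a} Θ M {N} → a ∈FVJ Θ ⊢ N → a ∈FVJ Θ ⊢ app M N
shadowed-appʳ Θ M = shadowed-mono Θ (λ _ _ → inj₂)

len : Ctx → ℕ
len nil      = 0
len (Γ ,, _) = suc (len Γ)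

len-cons : ∀ a Δ → len ((nil ,, a) ++c Δ) ≡ suc (len Δ)
len-cons a nil      = refl
len-cons a (Δ ,, _) = cong suc (len-cons a Δ)

++c-assoc : ∀ Θ a Δ → (Θ ,, a) ++c Δ ≡ Θ ++c ((nil ,, a) ++c Δ)
++c-assoc Θ a nil      = refl
++c-assoc Θ a (Δ ,, b) = cong (_,, b) (++c-assoc Θ a Δ)

-- Each binder of λΘ lowers levels by one, so a variable at level |Θ| + k in M is free at level k in λΘ.M.
lamCtx-shift : ∀ Θ M {k x} → FV M (len Θ + k) x → FV (lamCtx Θ M) k x
lamCtx-shift nil      M h = h
lamCtx-shift (Θ ,, a) M h = lamCtx-shift Θ (lam a M) (lower (len Θ + _) h)
  where
  lower : ∀ {A x} i → A (suc i) x → Oλ a A i x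
  lower zero    h = inj₂ h
  lower (suc i) h = h

-- Composites of shifts π_{a₁} ∘ … ∘ π_{aₙ} (left nested); the index is the
-- rightmost shift, the first one to act on a variable.
data Shifts : Var → Subst → Set where
  shift     : ∀ {a} → Shifts a (π a)
  shiftThen : ∀ {a b s} → Shifts b s → Shifts a (comp s (π a))

shiftsPop : ∀ {Γ Θ s a} → Γ ⊢ s ▷ Θ → Shifts a s →
            Σ Ctx λ Δ → (Γ ≡ (Θ ,, a) ++c Δ) ×
                        (∀ A k x → A k x → O s A (len ((nil ,, a) ++c Δ) + k) x)
shiftsPop tπ shift = nil , refl , λ A k x h → h
shiftsPop {Θ = Θ} {comp s (π a)} {a} (tcomp ds tπ) (shiftThen {b = b} sh) with shiftsPop ds sh
... | Δ , refl , raise =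
  (nil ,, b) ++c Δ , ++c-assoc (Θ ,, a) b Δ ,
  λ A k x h → subst (λ n → O s (O (π a) A) n x) (level k) (raise (O (π a) A) (suc k) x h)
  where
  open ≡-Reasoning
  level : ∀ k → len ((nil ,, b) ++c Δ) + suc k ≡ len ((nil ,, a) ++c ((nil ,, b) ++c Δ)) + k
  level k = begin
    len ((nil ,, b) ++c Δ) + suc k                   ≡⟨ +-suc (len ((nil ,, b) ++c Δ)) k ⟩
    suc (len ((nil ,, b) ++c Δ)) + k                 ≡⟨ cong (_+ k) (sym (len-cons a ((nil ,, b) ++c Δ))) ⟩
    len ((nil ,, a) ++c ((nil ,, b) ++c Δ)) + k      ∎

data SubstShape : Subst → Set where
  reduces   : ∀ {s s′} → s ⟶ˢ s′ → SubstShape s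
  identity  : SubstShape idS
  extension : ∀ {s N a} → SubstShape (cons s N a)
  shifts    : ∀ {a s} → Shifts a s → SubstShape s

-- Typing is needed for the ConsShift case: in Γ ⊢ ⟨s , N\a⟩ ∘ π_b the
-- variables a and b coincide.
substShape : ∀ {Γ s Θ} → Γ ⊢ s ▷ Θ → SubstShape s
substShape tid                      = identity
substShape tπ                       = shifts shift
substShape (tcons _ _)              = extension
substShape (tcomp _ tid)            = reduces IdR
substShape (tcomp _ (tcons _ _))    = reduces Map
substShape (tcomp _ (tcomp _ _))    = reduces Ass
substShape (tcomp ds tπ) with substShape ds
substShape (tcomp _ tπ)           | reduces r = reduces (compL r)
substShape (tcomp _ tπ)           | identity  = reduces IdShift
substShape (tcomp (tcons _ _) tπ) | extension = reduces ConsShift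
substShape (tcomp _ tπ)           | shifts sh = shifts (shiftThen sh)

-- The trichotomy behind the theorem: a derivable Γ ⊢ M is pure, has a
-- σπα-step, or has a shadowed context entry a (Γ = Γ₁,a,Δ with a free in
-- a,Δ ⊢ M), the situation in which α₂ applies.
data Progress (Γ : Ctx) (M : Term) : Set where
  pure     : Pure M → Progress Γ M
  reduces  : ∀ {M′} → M ⟶ M′ → Progress Γ M
  shadowed : ∀ Γ₁ a Δ → Γ ≡ (Γ₁ ,, a) ++c Δ → a ∈FVJ ((nil ,, a) ++c Δ) ⊢ M → Progress Γ M

-- s ∘ a for a composite of shifts s whose rightmost shift is π_a: the context
-- entry a popped by s is referred to, hence shadowed.
shiftsShadow : ∀ {Γ Θ s a} → Γ ⊢ s ▷ Θ → Shifts a s → Progress Γ (sub s (var a))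
shiftsShadow {a = a} ds sh with shiftsPop ds sh
... | Δ , Γ≡ , raise =
  shadowed _ a Δ Γ≡ (0 , lamCtx-shift ((nil ,, a) ++c Δ) _ (raise (FV (var a)) 0 a refl))

substVar : ∀ {Γ Θ s} b → Γ ⊢ s ▷ Θ → Progress Γ (sub s (var b))
substVar b ds with substShape ds
... | reduces r = reduces (subL r)
... | identity  = reduces IdVar
... | extension {a = a} with a ≟ b
...   | yes refl = reduces ConsVar
...   | no a≢b   = reduces (New a≢b)
substVar b ds | shifts (shift {a}) with a ≟ b
...   | yes refl = shiftsShadow ds shift
...   | no a≢b   = reduces (π₁ a≢b)
substVar b ds | shifts (shiftThen {a} sh) with a ≟ b
...   | yes refl = shiftsShadow ds (shiftThen sh)
...   | no a≢b   = reduces (π₂ a≢b)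

progressApp : ∀ {Γ M N} → Progress Γ M → Progress Γ N → Progress Γ (app M N)
progressApp (reduces r) _ = reduces (appL r)
progressApp {N = N} (shadowed Γ₁ a Δ eq fv) _ =
  shadowed Γ₁ a Δ eq (shadowed-appˡ ((nil ,, a) ++c Δ) N fv)
progressApp (pure p) (pure q)    = pure (papp p q)
progressApp (pure _) (reduces r) = reduces (appR r)
progressApp {M = M} (pure _) (shadowed Γ₁ a Δ eq fv) =
  shadowed Γ₁ a Δ eq (shadowed-appʳ ((nil ,, a) ++c Δ) M fv)

-- If the shadowed entry is the binder a itself, α₁ renames it to a fresh
-- variable; otherwise the shadowed entry lies in Γ.
progressLam : ∀ {Γ a M} → Progress (Γ ,, a) M → Progress Γ (lam a M)
progressLam (pure p)                          = pure (plam p)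
progressLam (reduces r)                       = reduces (lamC r)
progressLam {a = a} {M} (shadowed _ _ nil refl fv) =
  reduces (α₁ {b = suc (maxVar (lam a M))} fv (fresh (lam a M)))
progressLam (shadowed Γ₁ c (Δ ,, _) refl fv)  = shadowed Γ₁ c Δ refl fv

-- The progress lemma, by induction on the derivation; an explicit
-- substitution s ∘ M is a redex unless M is a variable.
progress : ∀ {Γ M} → Γ ⊢ M → Progress Γ M
progress ax                   = pure pvar
progress (weak _ _)           = pure pvar
progress (tapp d e)           = progressApp (progress d) (progress e)
progress (tlam d)             = progressLam (progress d)
progress (tsub ds ax)         = substVar _ ds
progress (tsub ds (weak _ _)) = substVar _ ds
progress (tsub _ (tapp _ _))  = reduces App
progress (tsub _ (tlam _))    = reduces Abs
progress (tsub _ (tsub _ _))  = reduces Clos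

mainTheorem6 : ∀ (Γ : Ctx) (M : Term) → Γ ⊢ M → NormalForm (Γ , M) → Pure M
-- A normal form has neither a σπα-step nor a shadowed entry (α₂ would rename
-- it to a fresh variable), so by progress it is pure.
mainTheorem6 _ M d normal with progress d
... | pure p      = p
... | reduces r   = ⊥-elim (normal _ (red r))
... | shadowed _ a Δ refl fv =
  ⊥-elim (normal _ (α₂ {b = suc (maxVar (lamCtx Θ M))} fv (fresh (lamCtx Θ M))))
  where
  Θ : Ctx
  Θ = (nil ,, a) ++c Δ
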